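{- We have $F(-1)=0$; $F(a,-1)=0$ for all integers $a\geqslant -2$; and $F(a,b,-1)=0$ for all integers $a,b\geqslant 1$.
   Context: Let $q,t$ be indeterminates. A standard Young tableau $T$ with $n$ boxes is a bijective filling of the Young diagram of a partition of $n$ by $1,\dots,n$, increasing along rows (left to right) and columns (bottom to top); rows $r$ counted from the bottom, columns $c$ from the left, starting at $1$. Let $z_i=q^{c-1}t^{r-1}$ where $i$ sits in row $r$, column $c$. Define \[\mathrm{wt}(T)=\prod_{i=2}^{n}\frac{1}{(1-z_i^{ -1})(1-qtz_{i-1}/z_i)}\prod_{1\leqslant i<j\leqslant n}\frac{(1-z_i/z_j)(1-qtz_i/z_j)}{(1-qz_i/z_j)(1-tz_i/z_j)},\] omitting any individual factor that vanishes, and for integers $a_2,\dots,a_n$ set $F(a_2,\dots,a_n)=\sum_T z_2^{a_2}\cdots z_n^{a_n}\mathrm{wt}(T)$ over all standard Young tableaux with $n$ boxes (one argument: $n=2$; two: $n=3$; three: $n=4$). -}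

module Defs where

open import Data.Bool using (Bool; true; false; _∧_; _∨_; not; if_then_else_)
open import Data.Nat as ℕ using (ℕ; zero; suc)
open import Data.Integer as ℤ using (ℤ; +_; 0ℤ; 1ℤ; -1ℤ)
open import Data.Product using (_×_; _,_)
open import Data.List using (List; []; _∷_; [_]; _++_; map; concatMap; foldr; filter; drop; length; zipWith; upTo)
open import Data.Bool.ListAction using (any)
open import Relation.Nullary.Decidable using (⌊_⌋)

-- Laurent monomials q^a t^b are exponent pairs (a , b) ∈ ℤ × ℤ.

Exp : Set
Exp = ℤ × ℤ

infixl 6 _⊕_
_⊕_ : Exp → Exp → Exp
(a , b) ⊕ (c , d) = (a ℤ.+ c , b ℤ.+ d)

⊝_ : Exp → Exp
⊝ (a , b) = (ℤ.- a , ℤ.- b)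

_⊖_ : Exp → Exp → Exp
x ⊖ y = x ⊕ (⊝ y)

scale : ℤ → Exp → Exp
scale k (a , b) = (k ℤ.* a , k ℤ.* b)

zeroExp : Exp
zeroExp = (0ℤ , 0ℤ)

-- Laurent polynomials in q, t with integer coefficients, as finite
-- formal sums of terms  c · q^a t^b  (not necessarily normalised).

LPoly : Set
LPoly = List (ℤ × Exp)

monoL : Exp → LPoly
monoL e = [ (1ℤ , e) ]

oneL : LPoly
oneL = monoL zeroExp

infixl 7 _*L_
_*L_ : LPoly → LPoly → LPoly
p *L r = concatMap (λ { (c , e) → map (λ { (d , f) → (c ℤ.* d , e ⊕ f) }) r }) p

prodL : List LPoly → LPoly
prodL = foldr _*L_ oneL

coeff : LPoly → ℤ → ℤ → ℤ
coeff [] i j = 0ℤ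
coeff ((c , (a , b)) ∷ p) i j =
  (if ⌊ a ℤ.≟ i ⌋ ∧ ⌊ b ℤ.≟ j ⌋ then c else 0ℤ) ℤ.+ coeff p i j

-- the factor 1 - q^a t^b, omitted (replaced by 1) when it vanishes,
-- i.e. when (a , b) = (0 , 0)
factor : Exp → LPoly
factor (a , b) =
  if ⌊ a ℤ.≟ 0ℤ ⌋ ∧ ⌊ b ℤ.≟ 0ℤ ⌋
  then oneL
  else (1ℤ , zeroExp) ∷ (-1ℤ , (a , b)) ∷ []

record Frac : Set where
  constructor _//_
  field
    num : LPoly
    den : LPoly

_+F_ : Frac → Frac → Frac
(n₁ // d₁) +F (n₂ // d₂) = ((n₁ *L d₂) ++ (n₂ *L d₁)) // (d₁ *L d₂)

sumF : List Frac → Frac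
sumF = foldr _+F_ ([] // oneL)

-- a fraction (with nonzero denominator) is the zero rational function
-- iff its numerator is the zero Laurent polynomial
IsZeroF : Frac → Set
IsZeroF fr = ∀ i j → coeff (Frac.num fr) i j ≡ 0ℤ
  where open import Relation.Binary.PropositionalEquality using (_≡_)

-- A cell is (row , col), 0-indexed
-- (row r+1, column c+1 in the paper's convention).  A tableau with n boxes
-- is the list of cells of entries 1, 2, ..., n.  Entry k+1 may be placed
-- in an empty cell whose lower and left neighbours (if inside the
-- quadrant) are already filled: this produces exactly the fillings of
-- Young diagrams increasing along rows and columns.

Cell : Set
Cell = ℕ × ℕ

_==C_ : Cell → Cell → Bool
(r , c) ==C (r' , c') = ⌊ r ℕ.≟ r' ⌋ ∧ ⌊ c ℕ.≟ c' ⌋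

memC : Cell → List Cell → Bool
memC x T = any (x ==C_) T

canAdd : List Cell → Cell → Bool
canAdd T (r , c) =
  not (memC (r , c) T)
  ∧ (belowOk r)
  ∧ (leftOk c)
  where
  belowOk : ℕ → Bool
  belowOk zero = true
  belowOk (suc r') = memC (r' , c) T
  leftOk : ℕ → Bool
  leftOk zero = true
  leftOk (suc c') = memC (r , c') T

candidates : ℕ → List Cell
candidates n = concatMap (λ r → map (λ c → (r , c)) (upTo n)) (upTo n)

SYT : ℕ → List (List Cell)
SYT zero = [ [] ]
SYT (suc k) =
  concatMap (λ T → map (λ x → T ++ [ x ]) (filter (λ x → canAdd T x ≟B true) (candidates (suc k))))
            (SYT k)
  where
  open import Data.Bool.Properties using () renaming (_≟_ to _≟B_)

-- z_i = q^(c-1) t^(r-1): exponent pair (c-1 , r-1) = (col , row) 0-indexed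
zExp : Cell → Exp
zExp (r , c) = (+ c , + r)

pairs : {A : Set} → List A → List (A × A)
pairs [] = []
pairs (x ∷ xs) = map (λ y → (x , y)) xs ++ pairs xs

consec : {A : Set} → List A → List (A × A)
consec (x ∷ y ∷ xs) = (x , y) ∷ consec (y ∷ xs)
consec _ = []

qtE qE tE : Exp
qtE = (1ℤ , 1ℤ)
qE  = (1ℤ , 0ℤ)
tE  = (0ℤ , 1ℤ)

-- numerator: prod_{i<j} (1 - z_i/z_j)(1 - qt z_i/z_j)
wtNum : List Exp → LPoly
wtNum es = prodL (concatMap (λ { (ei , ej) → factor (ei ⊖ ej) ∷ factor (qtE ⊕ (ei ⊖ ej)) ∷ [] }) (pairs es))

-- denominator: prod_{i≥2} (1 - z_i^{-1})(1 - qt z_{i-1}/z_i)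
--            · prod_{i<j} (1 - q z_i/z_j)(1 - t z_i/z_j)
wtDen : List Exp → LPoly
wtDen es =
  prodL (map (λ e → factor (⊝ e)) (drop 1 es))
  *L prodL (map (λ { (x , y) → factor (qtE ⊕ (x ⊖ y)) }) (consec es))
  *L prodL (concatMap (λ { (ei , ej) → factor (qE ⊕ (ei ⊖ ej)) ∷ factor (tE ⊕ (ei ⊖ ej)) ∷ [] }) (pairs es))

-- z_2^{a_2} ... z_n^{a_n} wt(T), for as = a_2 ∷ ... ∷ a_n
term : List ℤ → List Cell → Frac
term as T = (monoL mon *L wtNum es) // wtDen es
  where
  es = map zExp T
  mon = foldr _⊕_ zeroExp (zipWith scale as (drop 1 es))

F : List ℤ → Frac
F as = sumF (map (term as) (SYT (suc (length as))))

-- Group the standard Young tableaux with n boxes according to the subtableau T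
-- holding 1, …, n − 1.  The factor z₂^{a₂} ⋯ z_{n−1}^{a_{n−1}} depends only on T,
-- so with a_n = −1 the sum F splits into the corner sums Σ_x z_x^{−1} wt(T ∪ {x})
-- over the cells x addable to T, each multiplied by a monomial.  Every corner
-- sum vanishes for the seven tableaux T with at most three boxes; this is a
-- finite identity between rational functions in q and t, checked by bringing
-- the numerator to a normal form.

module Submission where

open import Defs
open import Algebra.Bundles using (CommutativeSemiring)
open import Algebra.Structures.Biased using (isCommutativeSemiringˡ)
open import Data.Bool using (Bool; true; false; if_then_else_; _∧_)
open import Data.Bool.Properties using () renaming (_≟_ to _≟ᵇ_)
open import Data.Integer as ℤ using (ℤ; 0ℤ; 1ℤ; -1ℤ; _+_; _*_; _-_; _≤_; +_; -[1+_])
import Data.Integer.Properties as ℤ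
open import Algebra.Properties.CommutativeSemigroup ℤ.+-commutativeSemigroup using (interchange; x∙yz≈y∙xz)
open import Data.Integer.Solver using (module +-*-Solver)
open import Data.List using (List; []; _∷_; [_]; _++_; _∷ʳ_; map; foldr; concat; concatMap; drop; filter; zipWith; length)
import Data.List.Properties as List
open import Data.List.Relation.Unary.All using (All; []; _∷_)
import Data.List.Relation.Unary.All as All
open import Data.List.Relation.Unary.All.Properties using (map⁺; concat⁺)
open import Data.Maybe using (Maybe; just; nothing)
open import Data.Nat as ℕ using (ℕ; zero; suc)
import Data.Nat.Properties as ℕ
open import Data.Product using (_×_; _,_; proj₁; proj₂)
open import Data.Product.Properties using (≡-dec)
open import Function.Bundles using (mk⇔)
open import Level using (0ℓ)
open import Relation.Binary.Bundles using (Setoid)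
open import Relation.Binary.Definitions using (DecidableEquality)
open import Relation.Binary.PropositionalEquality using (_≡_; refl; sym; trans; cong; cong₂; subst; subst₂; module ≡-Reasoning)
open import Relation.Binary.Structures using (IsEquivalence)
open import Relation.Nullary using (yes; no)
open import Relation.Nullary.Decidable using (⌊_⌋; isYes≗does; does-⇔)
open import Tactic.RingSolver.Core.AlmostCommutativeRing using (AlmostCommutativeRing; fromCommutativeSemiring)
import Tactic.RingSolver.NonReflective as NonReflective

⊕-comm : ∀ e f → e ⊕ f ≡ f ⊕ e
⊕-comm (e₁ , e₂) (f₁ , f₂) = cong₂ _,_ (ℤ.+-comm e₁ f₁) (ℤ.+-comm e₂ f₂)

⊕-assoc : ∀ e f g → (e ⊕ f) ⊕ g ≡ e ⊕ (f ⊕ g)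
⊕-assoc (e₁ , e₂) (f₁ , f₂) (g₁ , g₂) = cong₂ _,_ (ℤ.+-assoc e₁ f₁ g₁) (ℤ.+-assoc e₂ f₂ g₂)

⊕-identityˡ : ∀ e → zeroExp ⊕ e ≡ e
⊕-identityˡ (e₁ , e₂) = cong₂ _,_ (ℤ.+-identityˡ e₁) (ℤ.+-identityˡ e₂)

⊕-identityʳ : ∀ e → e ⊕ zeroExp ≡ e
⊕-identityʳ (e₁ , e₂) = cong₂ _,_ (ℤ.+-identityʳ e₁) (ℤ.+-identityʳ e₂)

scale-minusOne : ∀ e → scale -1ℤ e ≡ ⊝ e
scale-minusOne (e₁ , e₂) = cong₂ _,_ (ℤ.-1*i≡-i e₁) (ℤ.-1*i≡-i e₂)

-- Laurent polynomials up to equality of coefficients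

infix 4 _≈ₚ_
record _≈ₚ_ (p r : LPoly) : Set where
  constructor coeffwise
  field coeff-≡ : ∀ i j → coeff p i j ≡ coeff r i j
open _≈ₚ_

termCoeff : ℤ × Exp → ℤ → ℤ → ℤ
termCoeff (c , (a , b)) i j = if ⌊ a ℤ.≟ i ⌋ ∧ ⌊ b ℤ.≟ j ⌋ then c else 0ℤ

termCoeff-+ : ∀ c d e i j → termCoeff (c + d , e) i j ≡ termCoeff (c , e) i j + termCoeff (d , e) i j
termCoeff-+ c d (a , b) i j with ⌊ a ℤ.≟ i ⌋ ∧ ⌊ b ℤ.≟ j ⌋
... | true  = refl
... | false = refl

termCoeff-0 : ∀ e i j → termCoeff (0ℤ , e) i j ≡ 0ℤ
termCoeff-0 (a , b) i j with ⌊ a ℤ.≟ i ⌋ ∧ ⌊ b ℤ.≟ j ⌋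
... | true  = refl
... | false = refl

sumOver : {A : Set} → List A → (A → ℤ) → ℤ
sumOver xs f = foldr (λ x s → f x + s) 0ℤ xs

module _ {A : Set} where

  sumOver-0 : ∀ (xs : List A) → sumOver xs (λ _ → 0ℤ) ≡ 0ℤ
  sumOver-0 []       = refl
  sumOver-0 (x ∷ xs) = trans (ℤ.+-identityˡ _) (sumOver-0 xs)

  sumOver-++ : ∀ (xs ys : List A) f → sumOver (xs ++ ys) f ≡ sumOver xs f + sumOver ys f
  sumOver-++ []       ys f = sym (ℤ.+-identityˡ _)
  sumOver-++ (x ∷ xs) ys f = trans (cong (_+_ (f x)) (sumOver-++ xs ys f)) (sym (ℤ.+-assoc (f x) _ _))

  sumOver-cong : ∀ (xs : List A) {f g} → (∀ x → f x ≡ g x) → sumOver xs f ≡ sumOver xs g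
  sumOver-cong []       f≗g = refl
  sumOver-cong (x ∷ xs) f≗g = cong₂ _+_ (f≗g x) (sumOver-cong xs f≗g)

  sumOver-+ : ∀ (xs : List A) f g → sumOver xs (λ x → f x + g x) ≡ sumOver xs f + sumOver xs g
  sumOver-+ []       f g = refl
  sumOver-+ (x ∷ xs) f g =
    trans (cong (_+_ (f x + g x)) (sumOver-+ xs f g)) (interchange (f x) (g x) _ _)

  sumOver-*ˡ : ∀ (xs : List A) c f → sumOver xs (λ x → c * f x) ≡ c * sumOver xs f
  sumOver-*ˡ []       c f = sym (ℤ.*-zeroʳ c)
  sumOver-*ˡ (x ∷ xs) c f =
    trans (cong (_+_ (c * f x)) (sumOver-*ˡ xs c f)) (sym (ℤ.*-distribˡ-+ c (f x) _))

sumOver-map : ∀ {A B : Set} (xs : List A) (g : A → B) f → sumOver (map g xs) f ≡ sumOver xs (λ x → f (g x))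
sumOver-map []       g f = refl
sumOver-map (x ∷ xs) g f = cong (_+_ (f (g x))) (sumOver-map xs g f)

coeff-sumOver : ∀ p i j → coeff p i j ≡ sumOver p (λ x → termCoeff x i j)
coeff-sumOver []      i j = refl
coeff-sumOver (x ∷ p) i j = cong (_+_ (termCoeff x i j)) (coeff-sumOver p i j)

coeff-map : ∀ {A : Set} (g : A → ℤ × Exp) p i j → coeff (map g p) i j ≡ sumOver p (λ x → termCoeff (g x) i j)
coeff-map g p i j = trans (coeff-sumOver (map g p) i j) (sumOver-map p g (λ x → termCoeff x i j))

coeff-++ : ∀ p r i j → coeff (p ++ r) i j ≡ coeff p i j + coeff r i j
coeff-++ []      r i j = sym (ℤ.+-identityˡ _)
coeff-++ (x ∷ p) r i j =
  trans (cong (_+_ (termCoeff x i j)) (coeff-++ p r i j)) (sym (ℤ.+-assoc (termCoeff x i j) _ _))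

shiftTerm : ℤ × Exp → ℤ × Exp → ℤ × Exp
shiftTerm (c , e) (d , f) = (c * d , e ⊕ f)

shiftTerm-comm : ∀ x y → shiftTerm x y ≡ shiftTerm y x
shiftTerm-comm (c , e) (d , f) = cong₂ _,_ (ℤ.*-comm c d) (⊕-comm e f)

isYes-+ˡ : ∀ e f i → ⌊ e + f ℤ.≟ i ⌋ ≡ ⌊ f ℤ.≟ i - e ⌋
isYes-+ˡ e f i = begin
  ⌊ e + f ℤ.≟ i ⌋        ≡⟨ isYes≗does (e + f ℤ.≟ i) ⟩
  _                       ≡⟨ does-⇔ (mk⇔ to from) (e + f ℤ.≟ i) (f ℤ.≟ i - e) ⟩
  _                       ≡⟨ isYes≗does (f ℤ.≟ i - e) ⟨
  ⌊ f ℤ.≟ i - e ⌋        ∎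
  where
  open ≡-Reasoning
  open +-*-Solver
  to : e + f ≡ i → f ≡ i - e
  to refl = solve 2 (λ e f → f := (e :+ f) :- e) refl e f
  from : f ≡ i - e → e + f ≡ i
  from refl = solve 2 (λ e i → e :+ (i :- e) := i) refl e i

termCoeff-shift : ∀ x y i j →
                  termCoeff (shiftTerm x y) i j ≡ proj₁ x * termCoeff y (i - proj₁ (proj₂ x)) (j - proj₂ (proj₂ x))
termCoeff-shift (c , (e₁ , e₂)) (d , (f₁ , f₂)) i j
  rewrite isYes-+ˡ e₁ f₁ i | isYes-+ˡ e₂ f₂ j = pull-if (⌊ f₁ ℤ.≟ i - e₁ ⌋ ∧ ⌊ f₂ ℤ.≟ j - e₂ ⌋)
  where
  pull-if : ∀ b → (if b then c * d else 0ℤ) ≡ c * (if b then d else 0ℤ)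
  pull-if true  = refl
  pull-if false = sym (ℤ.*-zeroʳ c)

convolve : LPoly → ℤ → ℤ → ℤ × Exp → ℤ
convolve r i j (c , (e₁ , e₂)) = c * coeff r (i - e₁) (j - e₂)

coeff-map-shiftTerm : ∀ x r i j → coeff (map (shiftTerm x) r) i j ≡ convolve r i j x
coeff-map-shiftTerm x@(c , (e₁ , e₂)) r i j = begin
  coeff (map (shiftTerm x) r) i j                          ≡⟨ coeff-map (shiftTerm x) r i j ⟩
  sumOver r (λ y → termCoeff (shiftTerm x y) i j)          ≡⟨ sumOver-cong r (λ y → termCoeff-shift x y i j) ⟩
  sumOver r (λ y → c * termCoeff y (i - e₁) (j - e₂))      ≡⟨ sumOver-*ˡ r c _ ⟩
  c * sumOver r (λ y → termCoeff y (i - e₁) (j - e₂))      ≡⟨ cong (c *_) (coeff-sumOver r _ _) ⟨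
  c * coeff r (i - e₁) (j - e₂)                             ∎
  where open ≡-Reasoning

coeff-*ˡ : ∀ p r i j → coeff (p *L r) i j ≡ sumOver p (convolve r i j)
coeff-*ˡ []      r i j = refl
coeff-*ˡ (x ∷ p) r i j =
  trans (coeff-++ (map (shiftTerm x) r) (p *L r) i j)
        (cong₂ _+_ (coeff-map-shiftTerm x r i j) (coeff-*ˡ p r i j))

coeff-*ʳ : ∀ p r i j → coeff (p *L r) i j ≡ sumOver r (convolve p i j)
coeff-*ʳ [] r i j = sym (trans (sumOver-cong r (λ y → ℤ.*-zeroʳ (proj₁ y))) (sumOver-0 r))
coeff-*ʳ (x ∷ p) r i j = begin
  coeff (map (shiftTerm x) r ++ p *L r) i j
    ≡⟨ coeff-++ (map (shiftTerm x) r) (p *L r) i j ⟩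
  coeff (map (shiftTerm x) r) i j + coeff (p *L r) i j
    ≡⟨ cong₂ _+_ (coeff-map (shiftTerm x) r i j) (coeff-*ʳ p r i j) ⟩
  sumOver r (λ y → termCoeff (shiftTerm x y) i j) + sumOver r (convolve p i j)
    ≡⟨ sumOver-+ r (λ y → termCoeff (shiftTerm x y) i j) (convolve p i j) ⟨
  sumOver r (λ y → termCoeff (shiftTerm x y) i j + convolve p i j y)
    ≡⟨ sumOver-cong r step ⟩
  sumOver r (convolve (x ∷ p) i j) ∎
  where
  open ≡-Reasoning
  step : ∀ y → termCoeff (shiftTerm x y) i j + convolve p i j y ≡ convolve (x ∷ p) i j y
  step y@(d , (f₁ , f₂)) =
    trans (cong (_+ convolve p i j y) (trans (cong (λ z → termCoeff z i j) (shiftTerm-comm x y))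
                                             (termCoeff-shift y x i j)))
          (sym (ℤ.*-distribˡ-+ d _ _))

sumOver-*L : ∀ p r (g : ℤ × Exp → ℤ) → sumOver (p *L r) g ≡ sumOver p (λ x → sumOver r (λ y → g (shiftTerm x y)))
sumOver-*L []      r g = refl
sumOver-*L (x ∷ p) r g =
  trans (sumOver-++ (map (shiftTerm x) r) (p *L r) g)
        (cong₂ _+_ (sumOver-map r (shiftTerm x) g) (sumOver-*L p r g))

≈ₚ-isEquivalence : IsEquivalence _≈ₚ_
≈ₚ-isEquivalence = record
  { refl  = coeffwise λ i j → refl
  ; sym   = λ p≈r → coeffwise λ i j → sym (coeff-≡ p≈r i j)
  ; trans = λ p≈r r≈s → coeffwise λ i j → trans (coeff-≡ p≈r i j) (coeff-≡ r≈s i j)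
  }

≈ₚ-setoid : Setoid 0ℓ 0ℓ
≈ₚ-setoid = record { isEquivalence = ≈ₚ-isEquivalence }

++-congₚ : ∀ {p p′ r r′} → p ≈ₚ p′ → r ≈ₚ r′ → p ++ r ≈ₚ p′ ++ r′
++-congₚ {p} {p′} {r} {r′} p≈p′ r≈r′ = coeffwise λ i j →
  trans (coeff-++ p r i j) (trans (cong₂ _+_ (coeff-≡ p≈p′ i j) (coeff-≡ r≈r′ i j)) (sym (coeff-++ p′ r′ i j)))

++-commₚ : ∀ p r → p ++ r ≈ₚ r ++ p
++-commₚ p r = coeffwise λ i j →
  trans (coeff-++ p r i j) (trans (ℤ.+-comm (coeff p i j) _) (sym (coeff-++ r p i j)))

*L-comm : ∀ p r → p *L r ≈ₚ r *L p
*L-comm p r = coeffwise λ i j → trans (coeff-*ˡ p r i j) (sym (coeff-*ʳ r p i j))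

*L-congʳ : ∀ p {r r′} → r ≈ₚ r′ → p *L r ≈ₚ p *L r′
*L-congʳ p {r} {r′} r≈r′ = coeffwise λ i j → begin
  coeff (p *L r) i j           ≡⟨ coeff-*ˡ p r i j ⟩
  sumOver p (convolve r i j)   ≡⟨ sumOver-cong p (λ { (c , (e₁ , e₂)) → cong (c *_) (coeff-≡ r≈r′ _ _) }) ⟩
  sumOver p (convolve r′ i j)  ≡⟨ coeff-*ˡ p r′ i j ⟨
  coeff (p *L r′) i j          ∎
  where open ≡-Reasoning

*L-cong : ∀ {p p′ r r′} → p ≈ₚ p′ → r ≈ₚ r′ → p *L r ≈ₚ p′ *L r′
*L-cong {p} {p′} {r} {r′} p≈p′ r≈r′ = begin
  p *L r   ≈⟨ *L-congʳ p r≈r′ ⟩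
  p *L r′  ≈⟨ *L-comm p r′ ⟩
  r′ *L p  ≈⟨ *L-congʳ r′ p≈p′ ⟩
  r′ *L p′ ≈⟨ *L-comm r′ p′ ⟩
  p′ *L r′ ∎
  where open import Relation.Binary.Reasoning.Setoid ≈ₚ-setoid

*L-assoc : ∀ p r s → (p *L r) *L s ≈ₚ p *L (r *L s)
*L-assoc p r s = coeffwise λ i j → begin
  coeff ((p *L r) *L s) i j
    ≡⟨ coeff-*ˡ (p *L r) s i j ⟩
  sumOver (p *L r) (convolve s i j)
    ≡⟨ sumOver-*L p r (convolve s i j) ⟩
  sumOver p (λ x → sumOver r (λ y → convolve s i j (shiftTerm x y)))
    ≡⟨ sumOver-cong p (λ x → trans (sumOver-cong r (convolve-shiftTerm {i} {j} x)) (inner i j x)) ⟩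
  sumOver p (convolve (r *L s) i j)
    ≡⟨ coeff-*ˡ p (r *L s) i j ⟨
  coeff (p *L (r *L s)) i j ∎
  where
  open ≡-Reasoning
  open +-*-Solver
  sub-+ : ∀ i e f → i - (e + f) ≡ (i - e) - f
  sub-+ = solve 3 (λ i e f → i :- (e :+ f) := (i :- e) :- f) refl
  convolve-shiftTerm : ∀ {i j} x y → convolve s i j (shiftTerm x y)
    ≡ proj₁ x * convolve s (i - proj₁ (proj₂ x)) (j - proj₂ (proj₂ x)) y
  convolve-shiftTerm {i} {j} (c , (e₁ , e₂)) (d , (f₁ , f₂))
    rewrite sub-+ i e₁ f₁ | sub-+ j e₂ f₂ = ℤ.*-assoc c d _
  inner : ∀ i j x → sumOver r (λ y → proj₁ x * convolve s (i - proj₁ (proj₂ x)) (j - proj₂ (proj₂ x)) y)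
              ≡ convolve (r *L s) i j x
  inner i j (c , (e₁ , e₂)) = trans (sumOver-*ˡ r c _) (cong (c *_) (sym (coeff-*ˡ r s _ _)))

*L-identityˡ : ∀ p → oneL *L p ≈ₚ p
*L-identityˡ p = coeffwise λ i j → begin
  coeff (oneL *L p) i j                 ≡⟨ coeff-*ˡ oneL p i j ⟩
  1ℤ * coeff p (i - 0ℤ) (j - 0ℤ) + 0ℤ   ≡⟨ ℤ.+-identityʳ _ ⟩
  1ℤ * coeff p (i - 0ℤ) (j - 0ℤ)        ≡⟨ ℤ.*-identityˡ _ ⟩
  coeff p (i - 0ℤ) (j - 0ℤ)             ≡⟨ cong₂ (coeff p) (ℤ.+-identityʳ i) (ℤ.+-identityʳ j) ⟩
  coeff p i j                           ∎
  where open ≡-Reasoning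

*L-identityʳ : ∀ p → p *L oneL ≈ₚ p
*L-identityʳ p = IsEquivalence.trans ≈ₚ-isEquivalence (*L-comm p oneL) (*L-identityˡ p)

*L-distribʳ : ∀ r p p′ → (p ++ p′) *L r ≈ₚ p *L r ++ p′ *L r
*L-distribʳ r p p′ = coeffwise λ i j → begin
  coeff ((p ++ p′) *L r) i j                                 ≡⟨ coeff-*ˡ (p ++ p′) r i j ⟩
  sumOver (p ++ p′) (convolve r i j)                         ≡⟨ sumOver-++ p p′ (convolve r i j) ⟩
  sumOver p (convolve r i j) + sumOver p′ (convolve r i j)   ≡⟨ cong₂ _+_ (coeff-*ˡ p r i j) (coeff-*ˡ p′ r i j) ⟨
  coeff (p *L r) i j + coeff (p′ *L r) i j                   ≡⟨ coeff-++ (p *L r) (p′ *L r) i j ⟨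
  coeff (p *L r ++ p′ *L r) i j                              ∎
  where open ≡-Reasoning

laurentSemiring : CommutativeSemiring 0ℓ 0ℓ
laurentSemiring = record
  { Carrier = LPoly
  ; _≈_ = _≈ₚ_
  ; _+_ = _++_
  ; _*_ = _*L_
  ; 0# = []
  ; 1# = oneL
  ; isCommutativeSemiring = isCommutativeSemiringˡ record
    { +-isCommutativeMonoid = record
      { isMonoid = record
        { isSemigroup = record
          { isMagma = record { isEquivalence = ≈ₚ-isEquivalence ; ∙-cong = ++-congₚ }
          ; assoc = λ p r s → coeffwise λ i j → cong (λ z → coeff z i j) (List.++-assoc p r s)
          }
        ; identity = (λ p → coeffwise λ i j → refl)
                   , (λ p → coeffwise λ i j → cong (λ z → coeff z i j) (List.++-identityʳ p))
        }
      ; comm = ++-commₚ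
      }
    ; *-isCommutativeMonoid = record
      { isMonoid = record
        { isSemigroup = record
          { isMagma = record { isEquivalence = ≈ₚ-isEquivalence ; ∙-cong = *L-cong }
          ; assoc = *L-assoc
          }
        ; identity = *L-identityˡ , *L-identityʳ
        }
      ; comm = *L-comm
      }
    ; distribʳ = *L-distribʳ
    ; zeroˡ = λ p → coeffwise λ i j → refl
    }
  }

open CommutativeSemiring laurentSemiring using ()
  renaming (refl to ≈ₚ-refl; sym to ≈ₚ-sym; trans to ≈ₚ-trans; reflexive to ≈ₚ-reflexive; zeroʳ to *L-zeroʳ)

laurentRing : AlmostCommutativeRing 0ℓ 0ℓ
laurentRing = fromCommutativeSemiring laurentSemiring []≈?
  where
  []≈? : ∀ p → Maybe ([] ≈ₚ p)
  []≈? []      = just ≈ₚ-refl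
  []≈? (_ ∷ _) = nothing

open NonReflective laurentRing using (solve; _⊜_) renaming (_⊕_ to _:+_; _⊗_ to _:*_)

infix 4 _≈F_
record _≈F_ (f g : Frac) : Set where
  constructor _//≈_
  field
    num-≈ : Frac.num f ≈ₚ Frac.num g
    den-≈ : Frac.den f ≈ₚ Frac.den g
open _≈F_

≈F-refl : ∀ {f} → f ≈F f
≈F-refl = ≈ₚ-refl //≈ ≈ₚ-refl

≈F-sym : ∀ {f g} → f ≈F g → g ≈F f
≈F-sym (n //≈ d) = ≈ₚ-sym n //≈ ≈ₚ-sym d

≈F-trans : ∀ {f g h} → f ≈F g → g ≈F h → f ≈F h
≈F-trans (n₁ //≈ d₁) (n₂ //≈ d₂) = ≈ₚ-trans n₁ n₂ //≈ ≈ₚ-trans d₁ d₂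

+F-cong : ∀ {f f′ g g′} → f ≈F f′ → g ≈F g′ → f +F g ≈F f′ +F g′
+F-cong (n₁ //≈ d₁) (n₂ //≈ d₂) = ++-congₚ (*L-cong n₁ d₂) (*L-cong n₂ d₁) //≈ *L-cong d₁ d₂

+F-identityˡ : ∀ f → ([] // oneL) +F f ≈F f
+F-identityˡ (n // d) = *L-identityʳ n //≈ *L-identityˡ d

+F-assoc : ∀ f g h → (f +F g) +F h ≈F f +F (g +F h)
+F-assoc (n₁ // d₁) (n₂ // d₂) (n₃ // d₃) =
  solve 6 (λ n₁ d₁ n₂ d₂ n₃ d₃ →
             ((n₁ :* d₂ :+ n₂ :* d₁) :* d₃ :+ n₃ :* (d₁ :* d₂))
           ⊜ (n₁ :* (d₂ :* d₃) :+ (n₂ :* d₃ :+ n₃ :* d₂) :* d₁))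
        ≈ₚ-refl n₁ d₁ n₂ d₂ n₃ d₃
  //≈ *L-assoc d₁ d₂ d₃

sumF-++ : ∀ fs gs → sumF (fs ++ gs) ≈F sumF fs +F sumF gs
sumF-++ []       gs = ≈F-sym (+F-identityˡ (sumF gs))
sumF-++ (f ∷ fs) gs = ≈F-trans (+F-cong (≈F-refl {f}) (sumF-++ fs gs)) (≈F-sym (+F-assoc f (sumF fs) (sumF gs)))

sumF-map-cong : ∀ {A : Set} {f g : A → Frac} xs → (∀ x → f x ≈F g x) → sumF (map f xs) ≈F sumF (map g xs)
sumF-map-cong []       f≈g = ≈F-refl
sumF-map-cong (x ∷ xs) f≈g = +F-cong (f≈g x) (sumF-map-cong xs f≈g)

infixr 8 _·F_
_·F_ : LPoly → Frac → Frac
s ·F (n // d) = (s *L n) // d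

·F-distrib-+F : ∀ s f g → s ·F (f +F g) ≈F (s ·F f) +F (s ·F g)
·F-distrib-+F s (n₁ // d₁) (n₂ // d₂) =
  solve 5 (λ s n₁ d₁ n₂ d₂ →
             (s :* (n₁ :* d₂ :+ n₂ :* d₁)) ⊜ ((s :* n₁) :* d₂ :+ (s :* n₂) :* d₁))
        ≈ₚ-refl s n₁ d₁ n₂ d₂
  //≈ ≈ₚ-refl

sumF-map-·F : ∀ s fs → sumF (map (s ·F_) fs) ≈F s ·F sumF fs
sumF-map-·F s []       = ≈ₚ-sym (*L-zeroʳ s) //≈ ≈ₚ-refl
sumF-map-·F s (f ∷ fs) =
  ≈F-trans (+F-cong (≈F-refl {s ·F f}) (sumF-map-·F s fs)) (≈F-sym (·F-distrib-+F s f (sumF fs)))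

+F-num-zero : ∀ {f g} → Frac.num f ≈ₚ [] → Frac.num g ≈ₚ [] → Frac.num (f +F g) ≈ₚ []
+F-num-zero n₁≈0 n₂≈0 = ++-congₚ (*L-cong n₁≈0 ≈ₚ-refl) (*L-cong n₂≈0 ≈ₚ-refl)

·F-num-zero : ∀ s {f} → Frac.num f ≈ₚ [] → Frac.num (s ·F f) ≈ₚ []
·F-num-zero s n≈0 = ≈ₚ-trans (*L-congʳ s n≈0) (*L-zeroʳ s)

sumF-concat-num-zero : ∀ {fss} → All (λ fs → Frac.num (sumF fs) ≈ₚ []) fss → Frac.num (sumF (concat fss)) ≈ₚ []
sumF-concat-num-zero []                 = ≈ₚ-refl
sumF-concat-num-zero {fs ∷ fss} (z ∷ zs) =
  ≈ₚ-trans (num-≈ (sumF-++ fs (concat fss))) (+F-num-zero {sumF fs} z (sumF-concat-num-zero zs))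

-- Normal forms

_≟ᵉ_ : DecidableEquality Exp
_≟ᵉ_ = ≡-dec ℤ._≟_ ℤ._≟_

-- Lexicographic order, used only to keep normal forms sorted: soundness of
-- the normalising operations never depends on it.
_≤ᵉ_ : Exp → Exp → Bool
(a , b) ≤ᵉ (c , d) = if ⌊ a ℤ.≟ c ⌋ then b ℤ.≤ᵇ d else a ℤ.≤ᵇ c

-- (x ∷ p) +ₙ r, with p +ₙ_ passed in as `p+` so that the recursion is structural in r.
cons+ₙ : ℤ × Exp → LPoly → (LPoly → LPoly) → LPoly → LPoly
cons+ₙ x p p+ [] = x ∷ p
cons+ₙ x p p+ (y ∷ r) with proj₂ x ≟ᵉ proj₂ y | proj₁ x + proj₁ y ℤ.≟ 0ℤ | proj₂ x ≤ᵉ proj₂ y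
... | yes _ | yes _ | _     = p+ r
... | yes _ | no _  | _     = (proj₁ x + proj₁ y , proj₂ x) ∷ p+ r
... | no _  | _     | true  = x ∷ p+ (y ∷ r)
... | no _  | _     | false = y ∷ cons+ₙ x p p+ r

infixl 6 _+ₙ_
_+ₙ_ : LPoly → LPoly → LPoly
[]      +ₙ r = r
(x ∷ p) +ₙ r = cons+ₙ x p (p +ₙ_) r

coeff-cons+ₙ : ∀ x p p+ → (∀ r i j → coeff (p+ r) i j ≡ coeff p i j + coeff r i j) →
               ∀ r i j → coeff (cons+ₙ x p p+ r) i j ≡ coeff (x ∷ p) i j + coeff r i j
coeff-cons+ₙ x p p+ coeff-p+ [] i j = sym (ℤ.+-identityʳ _)
coeff-cons+ₙ x@(c , e) p p+ coeff-p+ (y@(d , f) ∷ r) i j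
  with proj₂ x ≟ᵉ proj₂ y | proj₁ x + proj₁ y ℤ.≟ 0ℤ | proj₂ x ≤ᵉ proj₂ y
... | yes refl | yes c+d≡0 | _ = begin
  coeff (p+ r) i j                     ≡⟨ coeff-p+ r i j ⟩
  P + R                                ≡⟨ ℤ.+-identityˡ (P + R) ⟨
  0ℤ + (P + R)                         ≡⟨ cong (_+ (P + R)) cancel ⟨
  (C + D) + (P + R)                    ≡⟨ interchange C D P R ⟩
  (C + P) + (D + R)                    ∎
  where
  open ≡-Reasoning
  C = termCoeff x i j
  D = termCoeff (d , e) i j
  P = coeff p i j
  R = coeff r i j
  cancel : C + D ≡ 0ℤ
  cancel = trans (sym (termCoeff-+ c d e i j)) (trans (cong (λ z → termCoeff (z , e) i j) c+d≡0) (termCoeff-0 e i j))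
... | yes refl | no _ | _ =
  trans (cong₂ _+_ (termCoeff-+ c d e i j) (coeff-p+ r i j))
        (interchange (termCoeff x i j) _ _ _)
... | no _ | _ | true =
  trans (cong (_+_ (termCoeff x i j)) (coeff-p+ (y ∷ r) i j))
        (sym (ℤ.+-assoc (termCoeff x i j) _ _))
... | no _ | _ | false =
  trans (cong (_+_ (termCoeff y i j)) (coeff-cons+ₙ x p p+ coeff-p+ r i j))
        (x∙yz≈y∙xz (termCoeff y i j) (coeff (x ∷ p) i j) (coeff r i j))

coeff-+ₙ : ∀ p r i j → coeff (p +ₙ r) i j ≡ coeff p i j + coeff r i j
coeff-+ₙ []      r i j = sym (ℤ.+-identityˡ _)
coeff-+ₙ (x ∷ p) r i j = coeff-cons+ₙ x p (p +ₙ_) (coeff-+ₙ p) r i j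

+ₙ-sound : ∀ p r → p +ₙ r ≈ₚ p ++ r
+ₙ-sound p r = coeffwise λ i j → trans (coeff-+ₙ p r i j) (sym (coeff-++ p r i j))

infixl 7 _*ₙ_
_*ₙ_ : LPoly → LPoly → LPoly
[]      *ₙ r = []
(x ∷ p) *ₙ r = map (shiftTerm x) r +ₙ (p *ₙ r)

*ₙ-sound : ∀ p r → p *ₙ r ≈ₚ p *L r
*ₙ-sound []      r = ≈ₚ-refl
*ₙ-sound (x ∷ p) r = ≈ₚ-trans (+ₙ-sound (map (shiftTerm x) r) (p *ₙ r)) (++-congₚ ≈ₚ-refl (*ₙ-sound p r))

prodₙ : List LPoly → LPoly
prodₙ = foldr _*ₙ_ oneL

prodₙ-sound : ∀ ps → prodₙ ps ≈ₚ prodL ps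
prodₙ-sound []       = ≈ₚ-refl
prodₙ-sound (p ∷ ps) = ≈ₚ-trans (*ₙ-sound p (prodₙ ps)) (*L-congʳ p (prodₙ-sound ps))

_+Fₙ_ : Frac → Frac → Frac
(n₁ // d₁) +Fₙ (n₂ // d₂) = (n₁ *ₙ d₂ +ₙ n₂ *ₙ d₁) // (d₁ *ₙ d₂)

+Fₙ-sound : ∀ f g → f +Fₙ g ≈F f +F g
+Fₙ-sound (n₁ // d₁) (n₂ // d₂) =
  ≈ₚ-trans (+ₙ-sound (n₁ *ₙ d₂) (n₂ *ₙ d₁)) (++-congₚ (*ₙ-sound n₁ d₂) (*ₙ-sound n₂ d₁))
  //≈ *ₙ-sound d₁ d₂

sumFₙ : List Frac → Frac
sumFₙ = foldr _+Fₙ_ ([] // oneL)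

sumFₙ-sound : ∀ fs → sumFₙ fs ≈F sumF fs
sumFₙ-sound []       = ≈F-refl
sumFₙ-sound (f ∷ fs) = ≈F-trans (+Fₙ-sound f (sumFₙ fs)) (+F-cong (≈F-refl {f}) (sumFₙ-sound fs))

numeratorFactors : List Exp → List LPoly
numeratorFactors es = concatMap (λ { (ei , ej) → factor (ei ⊖ ej) ∷ factor (qtE ⊕ (ei ⊖ ej)) ∷ [] }) (pairs es)

denominatorFactors₁ denominatorFactors₂ denominatorFactors₃ : List Exp → List LPoly
denominatorFactors₁ es = map (λ e → factor (⊝ e)) (drop 1 es)
denominatorFactors₂ es = map (λ { (x , y) → factor (qtE ⊕ (x ⊖ y)) }) (consec es)
denominatorFactors₃ es = concatMap (λ { (ei , ej) → factor (qE ⊕ (ei ⊖ ej)) ∷ factor (tE ⊕ (ei ⊖ ej)) ∷ [] }) (pairs es)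

wtNumₙ wtDenₙ : List Exp → LPoly
wtNumₙ es = prodₙ (numeratorFactors es)
wtDenₙ es = prodₙ (denominatorFactors₁ es) *ₙ prodₙ (denominatorFactors₂ es) *ₙ prodₙ (denominatorFactors₃ es)

wtNumₙ-sound : ∀ es → wtNumₙ es ≈ₚ wtNum es
wtNumₙ-sound es = prodₙ-sound (numeratorFactors es)

wtDenₙ-sound : ∀ es → wtDenₙ es ≈ₚ wtDen es
wtDenₙ-sound es =
  ≈ₚ-trans (*ₙ-sound (prodₙ A *ₙ prodₙ B) (prodₙ C))
           (*L-cong (≈ₚ-trans (*ₙ-sound (prodₙ A) (prodₙ B)) (*L-cong (prodₙ-sound A) (prodₙ-sound B)))
                    (prodₙ-sound C))
  where
  A = denominatorFactors₁ es
  B = denominatorFactors₂ es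
  C = denominatorFactors₃ es

-- Tableaux and corner sums

-- The exponent of z₂^{a₂} ⋯ z_n^{a_n} in `term`, for as = a₂ ∷ ⋯ and es = z₂ ∷ ⋯.
monomialExp : List ℤ → List Exp → Exp
monomialExp as es = foldr _⊕_ zeroExp (zipWith scale as es)

monomialExp-∷ʳ : ∀ as es c e → length as ≡ length es →
                 monomialExp (as ∷ʳ c) (es ∷ʳ e) ≡ monomialExp as es ⊕ scale c e
monomialExp-∷ʳ []       []       c e _ = trans (⊕-identityʳ (scale c e)) (sym (⊕-identityˡ (scale c e)))
monomialExp-∷ʳ (a ∷ as) (f ∷ es) c e len =
  trans (cong (scale a f ⊕_) (monomialExp-∷ʳ as es c e (ℕ.suc-injective len)))
        (sym (⊕-assoc (scale a f) _ _))

addableCells : ℕ → List Cell → List Cell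
addableCells k T = filter (λ x → canAdd T x ≟ᵇ true) (candidates (suc k))

SYT-suc : ∀ k → SYT (suc k) ≡ concatMap (λ T → map (T ∷ʳ_) (addableCells k T)) (SYT k)
SYT-suc k = refl

SYT-length : ∀ k → All (λ T → length T ≡ k) (SYT k)
SYT-length zero    = refl ∷ []
SYT-length (suc k) = concat⁺ (map⁺ (All.map extend (SYT-length k)))
  where
  extend : ∀ {T} → length T ≡ k → All (λ T′ → length T′ ≡ suc k) (map (T ∷ʳ_) (addableCells k T))
  extend {T} refl = map⁺ (All.universal (λ x → trans (List.length-++ T) (ℕ.+-comm (length T) 1)) _)

cornerTerm : List Cell → Cell → Frac
cornerTerm T x = (monoL (⊝ zExp x) *L wtNum es) // wtDen es
  where es = map zExp (T ∷ʳ x)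

cornerTermₙ : List Cell → Cell → Frac
cornerTermₙ T x = (monoL (⊝ zExp x) *ₙ wtNumₙ es) // wtDenₙ es
  where es = map zExp (T ∷ʳ x)

cornerTermₙ-sound : ∀ T x → cornerTermₙ T x ≈F cornerTerm T x
cornerTermₙ-sound T x =
  ≈ₚ-trans (*ₙ-sound (monoL (⊝ zExp x)) (wtNumₙ es)) (*L-congʳ (monoL (⊝ zExp x)) (wtNumₙ-sound es))
  //≈ wtDenₙ-sound es
  where es = map zExp (T ∷ʳ x)

CornerSumVanishes : ℕ → List Cell → Set
CornerSumVanishes k T = Frac.num (sumF (map (cornerTerm T) (addableCells k T))) ≈ₚ []

cornerSumVanishes-byNormalisation : ∀ k T → Frac.num (sumFₙ (map (cornerTermₙ T) (addableCells k T))) ≡ [] →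
                                    CornerSumVanishes k T
cornerSumVanishes-byNormalisation k T normal≡[] =
  ≈ₚ-trans (≈ₚ-sym (num-≈ normal≈sum)) (≈ₚ-reflexive normal≡[])
  where
  xs = addableCells k T
  normal≈sum : sumFₙ (map (cornerTermₙ T) xs) ≈F sumF (map (cornerTerm T) xs)
  normal≈sum = ≈F-trans (sumFₙ-sound (map (cornerTermₙ T) xs)) (sumF-map-cong xs (cornerTermₙ-sound T))

cornerSumsVanish-byNormalisation : ∀ k →
  All (λ T → Frac.num (sumFₙ (map (cornerTermₙ T) (addableCells k T))) ≡ []) (SYT k) → All (CornerSumVanishes k) (SYT k)
cornerSumsVanish-byNormalisation k = All.map (λ {T} → cornerSumVanishes-byNormalisation k T)

term-∷ʳ : ∀ as t T x → length T ≡ length as →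
          term (as ∷ʳ -1ℤ) ((t ∷ T) ∷ʳ x) ≈F monoL (monomialExp as (map zExp T)) ·F cornerTerm (t ∷ T) x
term-∷ʳ as t T x len =
  ≈ₚ-trans (≈ₚ-reflexive (cong (λ m → monoL m *L W) exponent)) (*L-assoc (monoL M) (monoL (⊝ zExp x)) W)
  //≈ ≈ₚ-refl
  where
  M = monomialExp as (map zExp T)
  W = wtNum (map zExp ((t ∷ T) ∷ʳ x))
  exponent : monomialExp (as ∷ʳ -1ℤ) (map zExp (T ∷ʳ x)) ≡ M ⊕ ⊝ zExp x
  exponent = begin
    monomialExp (as ∷ʳ -1ℤ) (map zExp (T ∷ʳ x))       ≡⟨ cong (monomialExp (as ∷ʳ -1ℤ)) (List.map-++ zExp T [ x ]) ⟩
    monomialExp (as ∷ʳ -1ℤ) (map zExp T ∷ʳ zExp x)    ≡⟨ monomialExp-∷ʳ as (map zExp T) -1ℤ (zExp x) len′ ⟩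
    M ⊕ scale -1ℤ (zExp x)                              ≡⟨ cong (M ⊕_) (scale-minusOne (zExp x)) ⟩
    M ⊕ ⊝ zExp x                                        ∎
    where
    open ≡-Reasoning
    len′ = sym (trans (List.length-map zExp T) len)

addableBlock-num-zero : ∀ as T xs → length T ≡ suc (length as) →
                        Frac.num (sumF (map (cornerTerm T) xs)) ≈ₚ [] →
                        Frac.num (sumF (map (term (as ∷ʳ -1ℤ)) (map (T ∷ʳ_) xs))) ≈ₚ []
addableBlock-num-zero as (t ∷ T) xs len corners≈0 =
  ≈ₚ-trans (num-≈ (≈F-trans blockAsScaled (sumF-map-·F M (map (cornerTerm (t ∷ T)) xs))))
           (·F-num-zero M {sumF (map (cornerTerm (t ∷ T)) xs)} corners≈0)
  where
  M = monoL (monomialExp as (map zExp T))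
  blockAsScaled : sumF (map (term (as ∷ʳ -1ℤ)) (map ((t ∷ T) ∷ʳ_) xs))
                  ≈F sumF (map (M ·F_) (map (cornerTerm (t ∷ T)) xs))
  blockAsScaled =
    subst₂ (λ l r → sumF l ≈F sumF r) (List.map-∘ xs) (List.map-∘ xs)
           (sumF-map-cong {f = λ x → term (as ∷ʳ -1ℤ) ((t ∷ T) ∷ʳ x)} {g = λ x → M ·F cornerTerm (t ∷ T) x} xs
                          (λ x → term-∷ʳ as t T x (ℕ.suc-injective len)))

-- The list bs is taken separately from as ∷ʳ -1ℤ: if the conclusion mentioned
-- F (as ∷ʳ -1ℤ), matching it against F (a ∷ -[1+ 0 ] ∷ []) would make the
-- conversion checker unfold both unnormalised numerators term by term.
F-∷ʳ-minusOne-vanishes : ∀ {k} bs as → bs ≡ as ∷ʳ -1ℤ → All (CornerSumVanishes k) (SYT k) →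
                         suc (length as) ≡ k → IsZeroF (F bs)
F-∷ʳ-minusOne-vanishes {k} _ as refl corners refl =
  subst (λ n → IsZeroF (sumF (map (term as′) (SYT (suc n))))) (sym length-as′) (coeff-≡ blocks≈0)
  where
  as′ = as ∷ʳ -1ℤ
  length-as′ : length as′ ≡ k
  length-as′ = trans (List.length-++ as) (ℕ.+-comm (length as) 1)
  block≈0 : ∀ {T} → length T ≡ k × CornerSumVanishes k T →
            Frac.num (sumF (map (term as′) (map (T ∷ʳ_) (addableCells k T)))) ≈ₚ []
  block≈0 {T} (len , corner≈0) = addableBlock-num-zero as T (addableCells k T) len corner≈0
  blocks≈0 : Frac.num (sumF (map (term as′) (SYT (suc k)))) ≈ₚ []
  blocks≈0 rewrite SYT-suc k | List.map-concatMap (term as′) (λ T → map (T ∷ʳ_) (addableCells k T)) (SYT k) =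
    sumF-concat-num-zero (map⁺ (All.zipWith (λ {T} → block≈0 {T}) (SYT-length k , corners)))

cornerSumsVanish₁ : All (CornerSumVanishes 1) (SYT 1)
cornerSumsVanish₁ = cornerSumsVanish-byNormalisation 1 (refl ∷ [])

cornerSumsVanish₂ : All (CornerSumVanishes 2) (SYT 2)
cornerSumsVanish₂ = cornerSumsVanish-byNormalisation 2 (refl ∷ refl ∷ [])

cornerSumsVanish₃ : All (CornerSumVanishes 3) (SYT 3)
cornerSumsVanish₃ = cornerSumsVanish-byNormalisation 3 (refl ∷ refl ∷ refl ∷ refl ∷ [])

lemma2p24 : IsZeroF (F (-[1+ 0 ] ∷ []))
    × (∀ (a : ℤ) → -[1+ 1 ] ≤ a → IsZeroF (F (a ∷ -[1+ 0 ] ∷ [])))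
    × (∀ (a b : ℤ) → + 1 ≤ a → + 1 ≤ b → IsZeroF (F (a ∷ b ∷ -[1+ 0 ] ∷ [])))
lemma2p24 =
    F-∷ʳ-minusOne-vanishes (-[1+ 0 ] ∷ []) [] refl cornerSumsVanish₁ refl
  , (λ a _ → F-∷ʳ-minusOne-vanishes (a ∷ -[1+ 0 ] ∷ []) (a ∷ []) refl cornerSumsVanish₂ refl)
  , (λ a b _ _ → F-∷ʳ-minusOne-vanishes (a ∷ b ∷ -[1+ 0 ] ∷ []) (a ∷ b ∷ []) refl cornerSumsVanish₃ refl)
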